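{- Let $L\ge6$ and $N=\left\lceil L(L+1)/4\right\rceil$, so that the PLRS generated by the $L$ coefficients $[1,0,\ldots,0,N]$ is complete. Fix $i\in\{2,\ldots,L-2\}$ and let $c_1=1$, $c_i=1$, $c_{L-1}=0$, $c_L=N$, and $c_j=0$ for all other $j\in\{2,\ldots,L-2\}$. Then the PLRS generated by $[c_1,\ldots,c_L]$ is complete.
   Context: A positive linear recurrence sequence (PLRS) generated by coefficients $[c_1,\ldots,c_L]$ (with $L\ge1$, $c_i$ nonnegative integers, $c_1>0$, $c_L>0$) is the sequence $\{H_n\}_{n\ge1}$ defined by $H_1=1$; for $1\le n<L$, $H_{n+1}=c_1H_n+c_2H_{n-1}+\cdots+c_nH_1+1$; and for $n\ge L$, $H_{n+1}=c_1H_n+\cdots+c_LH_{n+1-L}$. A sequence of positive integers is complete if every positive integer is a sum of distinct terms of the sequence. -}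

module Defs where

open import Data.Nat using (ℕ; zero; suc; _+_; _*_; _<ᵇ_; _≡ᵇ_; _≤_; _<_)
open import Data.Nat.DivMod using (_/_)
open import Data.Bool using (if_then_else_)
open import Data.Nat.ListAction using (sum)
open import Data.List using (List; []; _∷_; map; zipWith; length; upTo; reverse)
open import Data.List.Relation.Unary.All using (All)
open import Data.List.Relation.Unary.Unique.Propositional using (Unique)
open import Data.Product using (∃; _×_)
open import Relation.Binary.PropositionalEquality using (_≡_)

-- Given coefficients cs = [c₁,…,c_L] and the reversed list of the first n
-- terms [H_n, …, H_1], compute H_{n+1}:
--   Σ_{k ≤ min(n,L)} c_k H_{n+1-k}   (+ 1 if n < L).
-- (For n = 0 this gives H_1 = 0 + 1 = 1.)
nextTerm : List ℕ → List ℕ → ℕ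
nextTerm cs prev =
  sum (zipWith _*_ cs prev) + (if length prev <ᵇ length cs then 1 else 0)

revTerms : List ℕ → ℕ → List ℕ
revTerms cs zero = []
revTerms cs (suc n) = let p = revTerms cs n in nextTerm cs p ∷ p

-- PLRS term H_n (1-indexed; H 0 is a junk value 0, never used)
H : List ℕ → ℕ → ℕ
H cs zero = 0
H cs (suc n) = nextTerm cs (revTerms cs n)

Complete : (ℕ → ℕ) → Set
Complete h = ∀ m → 1 ≤ m →
  ∃ λ (S : List ℕ) → Unique S × All (λ n → 1 ≤ n) S × sum (map h S) ≡ m

-- N = ⌈ L(L+1)/4 ⌉ = ⌊ (L(L+1) + 3) / 4 ⌋
ceilN : ℕ → ℕ
ceilN L = (L * (L + 1) + 3) / 4

-- Coefficient list [c₁,…,c_L] with c₁ = 1, c_i = 1, c_{L-1} = 0, c_L = N,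
-- all other c_j = 0.  Entry at 0-based position k is c_{k+1}.
coeffs : ℕ → ℕ → List ℕ
coeffs L i = map c (upTo L)
  where
  c : ℕ → ℕ
  c k = if k ≡ᵇ 0 then 1
        else if suc k ≡ᵇ i then 1
        else if suc k ≡ᵇ L then ceilN L
        else 0

module Submission where

-- By Brown's criterion it suffices that h (n + 1) ≤ 1 + S n, where S n = h 1 + ⋯ + h n and h obeys
-- h (n + 1) = h n + h (n + 1 - i) + N h (n + 1 - L) + [n < L]. Below L this is immediate. From L on,
-- with h (n + 1) = h n + A n and B n = 1 + S (n - 1), the condition reads A n ≤ B n. Now A satisfies
-- the recurrence of h up to an additive N + 1 and B satisfies it exactly up to an additive L, so
-- slacks c₁, c₂, c₃ in A ≤ B at n - 1, n - i, n - L give slack c at n once c + 2 + 2N ≤ c₁ + c₂ + N c₃ + L.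
-- Strong induction with slacks 0, 2 and 2N on suitable ranges closes, starting from estimates at
-- L, L + 1, L + 2 which use the closed forms h k = k + S (k - i) and S k = k (k + 1)/2 + Σ_{j ≤ k} S (j - i)
-- for k ≤ L together with 2N ≤ L (L + 1)/2 + 1; the few small L are checked by evaluation.

open import Defs
open import Data.Bool using (true; false; if_then_else_)
open import Data.Empty using (⊥-elim)
open import Data.List using (List; []; _∷_; map; zipWith; length; applyUpTo)
open import Data.List.Properties using (length-applyUpTo; map-applyUpTo)
open import Data.List.Relation.Unary.All as All using (All; []; _∷_)
open import Data.List.Relation.Unary.AllPairs using ([]; _∷_)
open import Data.List.Relation.Unary.Unique.Propositional using (Unique)
open import Data.Nat
open import Data.Nat.Induction using (<-rec)
open import Data.Nat.DivMod using (m/n*n≤m; m≥n⇒m/n>0)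
open import Data.Nat.ListAction using (sum)
open import Data.Nat.Properties
open import Data.Nat.Tactic.RingSolver using (solve-∀)
open import Data.Product using (∃; _×_; _,_; proj₁)
open import Function using (_∘_)
open import Relation.Binary.PropositionalEquality
open import Relation.Nullary using (Dec; yes; no)
open import Relation.Nullary.Decidable using (from-yes; _→-dec_)

monotone-from-suc : (f : ℕ → ℕ) → (∀ n → f n ≤ f (suc n)) → ∀ {m n} → m ≤ n → f m ≤ f n
monotone-from-suc f step {m} {n} m≤n = subst (λ k → f m ≤ f k) (m+[n∸m]≡n m≤n) (go (n ∸ m))
  where
  go : ∀ d → f m ≤ f (m + d)
  go zero = ≤-reflexive (cong f (sym (+-identityʳ m)))
  go (suc d) = ≤-trans (go d) (subst (λ k → f (m + d) ≤ f k) (sym (+-suc m d)) (step (m + d)))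

module Brown (h : ℕ → ℕ) where

  partialSum : ℕ → ℕ
  partialSum zero = 0
  partialSum (suc n) = partialSum n + h (suc n)

  partialSum-mono : ∀ {m n} → m ≤ n → partialSum m ≤ partialSum n
  partialSum-mono = monotone-from-suc partialSum (λ n → m≤m+n (partialSum n) _)

  n≤partialSum : (∀ n → 1 ≤ h (suc n)) → ∀ n → n ≤ partialSum n
  n≤partialSum pos zero = z≤n
  n≤partialSum pos (suc n) = subst (_≤ partialSum n + h (suc n)) (+-comm n 1) (+-mono-≤ (n≤partialSum pos n) (pos n))

  -- Greedy: if m > partialSum n then h (suc n) ≤ m by Brown's condition, and m - h (suc n) ≤ partialSum n.
  representation : (∀ n → h (suc n) ≤ suc (partialSum n)) → ∀ n m → 1 ≤ m → m ≤ partialSum n →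
    ∃ λ (xs : List ℕ) → Unique xs × All (λ x → 1 ≤ x × x ≤ n) xs × sum (map h xs) ≡ m
  representation brown zero m 1≤m m≤0 = ⊥-elim (<-irrefl refl (≤-trans 1≤m m≤0))
  representation brown (suc n) m 1≤m m≤Sₙ₊₁ with m ≤? partialSum n
  ... | yes m≤Sₙ = let xs , unique , bounds , total = representation brown n m 1≤m m≤Sₙ in
    xs , unique , All.map (λ (1≤x , x≤n) → 1≤x , m≤n⇒m≤1+n x≤n) bounds , total
  ... | no m≰Sₙ with m ≟ h (suc n)
  ...   | yes m≡h = suc n ∷ [] , [] ∷ [] , (s≤s z≤n , ≤-refl) ∷ [] , trans (+-identityʳ _) (sym m≡h)
  ...   | no m≢h =
    let xs , unique , bounds , total = representation brown n (m ∸ h (suc n)) 0<m∸h m∸h≤S in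
    suc n ∷ xs , All.map (λ (_ , x≤n) x≡ → <-irrefl (sym x≡) (s≤s x≤n)) bounds ∷ unique
    , (s≤s z≤n , ≤-refl) ∷ All.map (λ (1≤x , x≤n) → 1≤x , m≤n⇒m≤1+n x≤n) bounds
    , trans (cong (h (suc n) +_) total) (m+[n∸m]≡n h≤m)
    where
    h≤m : h (suc n) ≤ m
    h≤m = ≤-trans (brown n) (≰⇒> m≰Sₙ)
    0<m∸h : 1 ≤ m ∸ h (suc n)
    0<m∸h = m<n⇒0<n∸m (≤∧≢⇒< h≤m (m≢h ∘ sym))
    m∸h≤S : m ∸ h (suc n) ≤ partialSum n
    m∸h≤S = subst (m ∸ h (suc n) ≤_) (m+n∸n≡m (partialSum n) (h (suc n))) (∸-monoˡ-≤ (h (suc n)) m≤Sₙ₊₁)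

  complete : (∀ n → 1 ≤ h (suc n)) → (∀ n → h (suc n) ≤ suc (partialSum n)) → Complete h
  complete pos brown m 1≤m with representation brown m m 1≤m (n≤partialSum pos m)
  ... | xs , unique , bounds , total = xs , unique , All.map proj₁ bounds , total

-- Unfolding the recurrence

sum-applyUpTo-cong : ∀ {f g : ℕ → ℕ} n → (∀ k → f k ≡ g k) → sum (applyUpTo f n) ≡ sum (applyUpTo g n)
sum-applyUpTo-cong zero f≗g = refl
sum-applyUpTo-cong (suc n) f≗g = cong₂ _+_ (f≗g 0) (sum-applyUpTo-cong n (f≗g ∘ suc))

sum-applyUpTo-+ : ∀ (f g : ℕ → ℕ) n →
  sum (applyUpTo (λ k → f k + g k) n) ≡ sum (applyUpTo f n) + sum (applyUpTo g n)
sum-applyUpTo-+ f g zero = refl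
sum-applyUpTo-+ f g (suc n) =
  trans (cong (f 0 + g 0 +_) (sum-applyUpTo-+ (f ∘ suc) (g ∘ suc) n)) (interchange (f 0) (g 0) _ _)
  where
  interchange : ∀ a b c d → a + b + (c + d) ≡ a + c + (b + d)
  interchange = solve-∀

sum-applyUpTo-zero : ∀ n → sum (applyUpTo (λ _ → 0) n) ≡ 0
sum-applyUpTo-zero zero = refl
sum-applyUpTo-zero (suc n) = sum-applyUpTo-zero n

point : ℕ → ℕ → ℕ → ℕ
point a x k = if k ≡ᵇ a then x else 0

sum-applyUpTo-point : ∀ a x n → a < n → sum (applyUpTo (point a x) n) ≡ x
sum-applyUpTo-point zero x (suc n) _ = trans (cong (x +_) (sum-applyUpTo-zero n)) (+-identityʳ x)
sum-applyUpTo-point (suc a) x (suc n) a<n = sum-applyUpTo-point a x n (s≤s⁻¹ a<n)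

sum-zipWith-applyUpTo : ∀ (f g : ℕ → ℕ) m n → (∀ k → n ≤ k → g k ≡ 0) →
  sum (zipWith _*_ (applyUpTo f m) (applyUpTo g n)) ≡ sum (applyUpTo (λ k → f k * g k) m)
sum-zipWith-applyUpTo f g zero n g≡0 = refl
sum-zipWith-applyUpTo f g (suc m) zero g≡0 = sym (begin
  sum (applyUpTo (λ k → f k * g k) (suc m))
    ≡⟨ sum-applyUpTo-cong (suc m) (λ k → trans (cong (f k *_) (g≡0 k z≤n)) (*-zeroʳ (f k))) ⟩
  sum (applyUpTo (λ _ → 0) (suc m))
    ≡⟨ sum-applyUpTo-zero (suc m) ⟩
  0 ∎)
  where open ≡-Reasoning
sum-zipWith-applyUpTo f g (suc m) (suc n) g≡0 =
  cong (f 0 * g 0 +_) (sum-zipWith-applyUpTo (f ∘ suc) (g ∘ suc) m n (λ k n≤k → g≡0 (suc k) (s≤s n≤k)))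

revTerms≡applyUpTo : ∀ cs n → revTerms cs n ≡ applyUpTo (λ k → H cs (n ∸ k)) n
revTerms≡applyUpTo cs zero = refl
revTerms≡applyUpTo cs (suc n) = cong (H cs (suc n) ∷_) (revTerms≡applyUpTo cs n)

H-suc : ∀ cs c l → cs ≡ applyUpTo c l → ∀ n →
  H cs (suc n) ≡ sum (applyUpTo (λ k → c k * H cs (n ∸ k)) l) + (if n <ᵇ l then 1 else 0)
H-suc cs c l refl n = begin
  H cs (suc n)
    ≡⟨ cong (λ ts → sum (zipWith _*_ cs ts) + (if length ts <ᵇ length cs then 1 else 0)) (revTerms≡applyUpTo cs n) ⟩
  sum (zipWith _*_ cs (applyUpTo past n)) + (if length (applyUpTo past n) <ᵇ length cs then 1 else 0)
    ≡⟨ cong₂ (λ s m → s + (if m <ᵇ length cs then 1 else 0))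
             (sum-zipWith-applyUpTo c past l n (λ k n≤k → cong (H cs) (m≤n⇒m∸n≡0 n≤k)))
             (length-applyUpTo past n) ⟩
  sum (applyUpTo (λ k → c k * past k) l) + (if n <ᵇ length cs then 1 else 0)
    ≡⟨ cong (λ m → sum (applyUpTo (λ k → c k * past k) l) + (if n <ᵇ m then 1 else 0)) (length-applyUpTo c l) ⟩
  sum (applyUpTo (λ k → c k * past k) l) + (if n <ᵇ l then 1 else 0) ∎
  where
  open ≡-Reasoning
  past : ℕ → ℕ
  past k = H cs (n ∸ k)

m+o≡n⇒m≤n : ∀ {m n} o → m + o ≡ n → m ≤ n
m+o≡n⇒m≤n {m} o refl = m≤m+n m o

triangle : ℕ → ℕ
triangle zero = 0
triangle (suc n) = triangle n + suc n

double-triangle : ∀ n → n * (n + 1) ≡ 2 * triangle n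
double-triangle zero = refl
double-triangle (suc n) = begin
  suc n * (suc n + 1)             ≡⟨ step n ⟩
  n * (n + 1) + 2 * suc n         ≡⟨ cong (_+ 2 * suc n) (double-triangle n) ⟩
  2 * triangle n + 2 * suc n      ≡⟨ *-distribˡ-+ 2 (triangle n) (suc n) ⟨
  2 * triangle (suc n)            ∎
  where
  open ≡-Reasoning
  step : ∀ n → suc n * (suc n + 1) ≡ n * (n + 1) + 2 * suc n
  step = solve-∀

n≤triangle : ∀ n → n ≤ triangle n
n≤triangle zero = z≤n
n≤triangle (suc n) = m≤n+m (suc n) (triangle n)

2*n≤triangle+1 : ∀ n → 2 * n ≤ triangle n + 1
2*n≤triangle+1 zero = z≤n
2*n≤triangle+1 (suc n) = subst₂ _≤_ (lhs n) (rhs (triangle n) n) (+-monoˡ-≤ (n + 2) (n≤triangle n))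
  where
  lhs : ∀ n → n + (n + 2) ≡ 2 * suc n
  lhs = solve-∀
  rhs : ∀ t n → t + (n + 2) ≡ t + suc n + 1
  rhs = solve-∀

3*n+6≤triangle : ∀ n → 7 ≤ n → 3 * n + 6 ≤ triangle n
3*n+6≤triangle n 7≤n with t , refl ← m≤n⇒∃[o]m+o≡n 7≤n =
  *-cancelˡ-≤ 2 (m+o≡n⇒m≤n (2 + 9 * t + t * t) (trans (expand t) (double-triangle (7 + t))))
  where
  expand : ∀ t → 2 * (3 * (7 + t) + 6) + (2 + 9 * t + t * t) ≡ (7 + t) * (7 + t + 1)
  expand = solve-∀

triangle-sum-gap : ∀ n → 8 ≤ n → triangle (suc n) + 1 ≤ triangle (n ∸ 1) + triangle (n ∸ 2)
triangle-sum-gap n 8≤n with t , refl ← m≤n⇒∃[o]m+o≡n 8≤n =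
  *-cancelˡ-≤ 2 (subst₂ _≤_ (sym doubled-lhs) (sym doubled-rhs) (m≤m+n _ _))
  where
  expand : ∀ t → (7 + t) * (7 + t + 1) + (6 + t) * (6 + t + 1) ≡ (9 + t) * (9 + t + 1) + 2 + (6 + 9 * t + t * t)
  expand = solve-∀
  doubled-lhs : 2 * (triangle (9 + t) + 1) ≡ (9 + t) * (9 + t + 1) + 2
  doubled-lhs = trans (*-distribˡ-+ 2 (triangle (9 + t)) 1) (cong (_+ 2) (sym (double-triangle (9 + t))))
  doubled-rhs : 2 * (triangle (7 + t) + triangle (6 + t)) ≡ (9 + t) * (9 + t + 1) + 2 + (6 + 9 * t + t * t)
  doubled-rhs = trans (*-distribˡ-+ 2 (triangle (7 + t)) (triangle (6 + t)))
    (trans (sym (cong₂ _+_ (double-triangle (7 + t)) (double-triangle (6 + t)))) (expand t))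

2*ceilN≤triangle+1 : ∀ n → 2 * ceilN n ≤ triangle n + 1
2*ceilN≤triangle+1 n = s≤s⁻¹ (*-cancelˡ-< 2 _ _ (begin-strict
  2 * (2 * ceilN n)          ≡⟨ quadruple (ceilN n) ⟩
  ceilN n * 4                ≤⟨ m/n*n≤m (n * (n + 1) + 3) 4 ⟩
  n * (n + 1) + 3            ≡⟨ cong (_+ 3) (double-triangle n) ⟩
  2 * triangle n + 3         <⟨ +-monoʳ-< (2 * triangle n) (n<1+n 3) ⟩
  2 * triangle n + 4         ≡⟨ regroup (triangle n) ⟩
  2 * suc (triangle n + 1)   ∎))
  where
  open ≤-Reasoning
  quadruple : ∀ x → 2 * (2 * x) ≡ x * 4
  quadruple = solve-∀
  regroup : ∀ t → 2 * t + 4 ≡ 2 * suc (t + 1)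
  regroup = solve-∀

4+n≤2*[n∸1]+2*[n∸2] : ∀ n → 4 ≤ n → 4 + n ≤ 2 * (n ∸ 1) + 2 * (n ∸ 2)
4+n≤2*[n∸1]+2*[n∸2] n 4≤n with t , refl ← m≤n⇒∃[o]m+o≡n 4≤n = m+o≡n⇒m≤n (2 + 3 * t) (expand t)
  where
  expand : ∀ t → 4 + (4 + t) + (2 + 3 * t) ≡ 2 * (3 + t) + 2 * (2 + t)
  expand = solve-∀

4+n≤2*n+2*[n∸2] : ∀ n → 3 ≤ n → 4 + n ≤ 2 * n + 2 * (n ∸ 2)
4+n≤2*n+2*[n∸2] n 3≤n with t , refl ← m≤n⇒∃[o]m+o≡n 3≤n = m+o≡n⇒m≤n (1 + 3 * t) (expand t)
  where
  expand : ∀ t → 4 + (3 + t) + (1 + 3 * t) ≡ 2 * (3 + t) + 2 * (1 + t)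
  expand = solve-∀

4+n≤2*n+2*[n∸1] : ∀ n → 2 ≤ n → 4 + n ≤ 2 * n + 2 * (n ∸ 1)
4+n≤2*n+2*[n∸1] n 2≤n with t , refl ← m≤n⇒∃[o]m+o≡n 2≤n = m+o≡n⇒m≤n (3 * t) (expand t)
  where
  expand : ∀ t → 4 + (2 + t) + 3 * t ≡ 2 * (2 + t) + 2 * (1 + t)
  expand = solve-∀

1≤ceilN : ∀ n → 1 ≤ ceilN (suc n)
1≤ceilN n = m≥n⇒m/n>0 {suc n * (suc n + 1) + 3} {4} (+-monoˡ-≤ 3 (s≤s z≤n))

≡ᵇ-refl : ∀ n → (n ≡ᵇ n) ≡ true
≡ᵇ-refl zero = refl
≡ᵇ-refl (suc n) = ≡ᵇ-refl n

≢⇒≡ᵇ≡false : ∀ {m n} → m ≢ n → (m ≡ᵇ n) ≡ false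
≢⇒≡ᵇ≡false {zero} {zero} m≢n = ⊥-elim (m≢n refl)
≢⇒≡ᵇ≡false {zero} {suc n} m≢n = refl
≢⇒≡ᵇ≡false {suc m} {zero} m≢n = refl
≢⇒≡ᵇ≡false {suc m} {suc n} m≢n = ≢⇒≡ᵇ≡false (m≢n ∘ cong suc)

m∸n<m : ∀ {m n} → 1 ≤ m → 1 ≤ n → m ∸ n < m
m∸n<m {suc m} {suc n} _ _ = s≤s (m∸n≤m m n)

∸-comm : ∀ m a b → m ∸ a ∸ b ≡ m ∸ b ∸ a
∸-comm m a b = trans (∸-+-assoc m a b) (trans (cong (m ∸_) (+-comm a b)) (sym (∸-+-assoc m b a)))

module Sequence (i' L' : ℕ) where

  L i N : ℕ
  L = suc L'
  i = suc i'
  N = ceilN L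

  h : ℕ → ℕ
  h = H (coeffs L i)

  open Brown h public using () renaming (partialSum to S; partialSum-mono to S-mono)

  χ : ℕ → ℕ
  χ n = if n <ᵇ L then 1 else 0

  A B : ℕ → ℕ
  A n = h (n ∸ i') + N * h (n ∸ L')
  B n = suc (S (n ∸ 1))

  Slack : ℕ → ℕ → Set
  Slack c n = A n + c ≤ B n

  slack? : ∀ c n → Dec (Slack c n)
  slack? c n = A n + c ≤? B n

module Properties (i' L' : ℕ) (1≤i' : 1 ≤ i') (i'+2≤L' : i' + 2 ≤ L') (5≤L' : 5 ≤ L') where

  open Sequence i' L'

  i'<L' : i' < L'
  i'<L' = <-≤-trans (m<m+n i' (s≤s z≤n)) i'+2≤L'

  -- Definitionally the coefficient function inside coeffs, so that map-applyUpTo applies.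
  coefficient : ℕ → ℕ
  coefficient k = if k ≡ᵇ 0 then 1 else if suc k ≡ᵇ i then 1 else if suc k ≡ᵇ L then N else 0

  coeffs≡applyUpTo : coeffs L i ≡ applyUpTo coefficient L
  coeffs≡applyUpTo = map-applyUpTo (λ k → k) coefficient L

  coefficient-split : ∀ (f : ℕ → ℕ) k →
    coefficient k * f k ≡ point 0 (f 0) k + point i' (f i') k + point L' (N * f L') k
  coefficient-split f k with k ≟ 0
  ... | yes refl rewrite ≢⇒≡ᵇ≡false {0} {i'} (<⇒≢ 1≤i') | ≢⇒≡ᵇ≡false {0} {L'} (<⇒≢ (<-trans 1≤i' i'<L'))
    = trans (+-identityʳ (f 0)) (sym (trans (+-identityʳ _) (+-identityʳ _)))
  ... | no k≢0 rewrite ≢⇒≡ᵇ≡false k≢0 with k ≟ i'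
  ...   | yes refl rewrite ≡ᵇ-refl k | ≢⇒≡ᵇ≡false (<⇒≢ i'<L') = trans (+-identityʳ (f k)) (sym (+-identityʳ _))
  ...   | no k≢i' rewrite ≢⇒≡ᵇ≡false k≢i' with k ≟ L'
  ...     | yes refl rewrite ≡ᵇ-refl k = refl
  ...     | no k≢L' rewrite ≢⇒≡ᵇ≡false k≢L' = refl

  sum-coefficients : ∀ (f : ℕ → ℕ) → sum (applyUpTo (λ k → coefficient k * f k) L) ≡ f 0 + f i' + N * f L'
  sum-coefficients f = begin
    sum (applyUpTo (λ k → coefficient k * f k) L)
      ≡⟨ sum-applyUpTo-cong L (coefficient-split f) ⟩
    sum (applyUpTo (λ k → point 0 (f 0) k + point i' (f i') k + point L' (N * f L') k) L)
      ≡⟨ sum-applyUpTo-+ (λ k → point 0 (f 0) k + point i' (f i') k) (point L' (N * f L')) L ⟩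
    sum (applyUpTo (λ k → point 0 (f 0) k + point i' (f i') k) L) + sum (applyUpTo (point L' (N * f L')) L)
      ≡⟨ cong (_+ sum (applyUpTo (point L' (N * f L')) L)) (sum-applyUpTo-+ (point 0 (f 0)) (point i' (f i')) L) ⟩
    sum (applyUpTo (point 0 (f 0)) L) + sum (applyUpTo (point i' (f i')) L) + sum (applyUpTo (point L' (N * f L')) L)
      ≡⟨ cong₂ _+_ (cong₂ _+_ (sum-applyUpTo-point 0 (f 0) L z<s)
                              (sum-applyUpTo-point i' (f i') L (m<n⇒m<1+n i'<L')))
                   (sum-applyUpTo-point L' (N * f L') L ≤-refl) ⟩
    f 0 + f i' + N * f L' ∎
    where open ≡-Reasoning

  h-suc : ∀ n → h (suc n) ≡ h n + h (n ∸ i') + N * h (n ∸ L') + χ n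
  h-suc n = trans (H-suc (coeffs L i) coefficient L coeffs≡applyUpTo n)
                  (cong (_+ χ n) (sum-coefficients (λ k → h (n ∸ k))))

  χ-< : ∀ {n} → n < L → χ n ≡ 1
  χ-< {n} n<L with n <ᵇ L | <⇒<ᵇ n<L
  ... | true | _ = refl

  χ-≥ : ∀ {n} → L ≤ n → χ n ≡ 0
  χ-≥ {n} L≤n with n <ᵇ L | <ᵇ⇒< n L
  ... | false | _ = refl
  ... | true | n<L = ⊥-elim (<⇒≱ (n<L _) L≤n)

  χ≤1 : ∀ n → χ n ≤ 1
  χ≤1 n with n <ᵇ L
  ... | true = ≤-refl
  ... | false = z≤n

  h-mono : ∀ {m n} → m ≤ n → h m ≤ h n
  h-mono = monotone-from-suc h λ n → subst (h n ≤_) (sym (h-suc n))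
    (≤-trans (m≤m+n (h n) _) (≤-trans (m≤m+n _ _) (m≤m+n _ _)))

  h-positive : ∀ n → 1 ≤ h (suc n)
  h-positive n = h-mono {1} {suc n} (s≤s z≤n)

  h-∸≡0 : ∀ {m n} → m ≤ n → h (m ∸ n) ≡ 0
  h-∸≡0 m≤n = cong h (m≤n⇒m∸n≡0 m≤n)

  h-2 : h 2 ≡ 2
  h-2 rewrite h-suc 1 | h-∸≡0 {1} {i'} 1≤i' | h-∸≡0 {1} {L'} (≤-trans (s≤s z≤n) 5≤L') | *-zeroʳ N
            | χ-< {1} (s≤s (≤-trans (s≤s z≤n) 5≤L')) = refl

  S-∸ : ∀ m a → S (m ∸ a) ≡ S (m ∸ suc a) + h (m ∸ a)
  S-∸ zero a rewrite 0∸n≡0 a = refl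
  S-∸ (suc m) zero = refl
  S-∸ (suc m) (suc a) = S-∸ m a

  h≤S : ∀ {m n} → m ≤ n → h m ≤ S n
  h≤S {zero} _ = z≤n
  h≤S {suc m} m<n = ≤-trans (m≤n+m (h (suc m)) (S m)) (S-mono m<n)

  brown-below-L : ∀ n → n < L → h (suc n) ≤ suc (S n)
  brown-below-L n n<L rewrite h-suc n | χ-< n<L | h-∸≡0 (s≤s⁻¹ n<L) | *-zeroʳ N | S-∸ n 0 = begin
    h n + h (n ∸ i') + 0 + 1    ≡⟨ cong (_+ 1) (+-identityʳ _) ⟩
    h n + h (n ∸ i') + 1        ≡⟨ +-comm _ 1 ⟩
    suc (h n + h (n ∸ i'))      ≤⟨ s≤s (+-monoʳ-≤ (h n) (h≤S (∸-monoʳ-≤ n 1≤i'))) ⟩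
    suc (h n + S (n ∸ 1))       ≡⟨ cong suc (+-comm (h n) _) ⟩
    suc (S (n ∸ 1) + h n)       ∎
    where open ≤-Reasoning

  brown-from-slack : ∀ n → L ≤ n → Slack 0 n → h (suc n) ≤ suc (S n)
  brown-from-slack n L≤n slack rewrite h-suc n | χ-≥ L≤n | S-∸ n 0 = begin
    h n + h (n ∸ i') + N * h (n ∸ L') + 0   ≡⟨ trans (+-identityʳ _) (+-assoc (h n) _ _) ⟩
    h n + A n                               ≤⟨ +-monoʳ-≤ (h n) (subst (_≤ B n) (+-identityʳ (A n)) slack) ⟩
    h n + suc (S (n ∸ 1))                   ≡⟨ +-suc (h n) _ ⟩
    suc (h n + S (n ∸ 1))                   ≡⟨ cong suc (+-comm (h n) _) ⟩
    suc (S (n ∸ 1) + h n)                   ∎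
    where open ≤-Reasoning

  h-≤ : ∀ n → h n ≤ h (n ∸ 1) + h (n ∸ i) + N * h (n ∸ L) + 1
  h-≤ zero = z≤n
  h-≤ (suc n) rewrite h-suc n = +-monoʳ-≤ (h n + h (n ∸ i') + N * h (n ∸ L')) (χ≤1 n)

  A-≤ : ∀ n → A n ≤ A (n ∸ 1) + A (n ∸ i) + N * A (n ∸ L) + suc N
  A-≤ n = ≤-trans (+-mono-≤ (h-≤ (n ∸ i')) (*-monoʳ-≤ N (h-≤ (n ∸ L')))) (≤-reflexive regrouped)
    where
    regroup : ∀ a₁ a₂ a₃ b₁ b₂ b₃ N →
      a₁ + a₂ + N * a₃ + 1 + N * (b₁ + b₂ + N * b₃ + 1)
        ≡ (a₁ + N * b₁) + (a₂ + N * b₂) + N * (a₃ + N * b₃) + suc N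
    regroup = solve-∀
    regrouped : h (n ∸ i' ∸ 1) + h (n ∸ i' ∸ i) + N * h (n ∸ i' ∸ L) + 1
                  + N * (h (n ∸ L' ∸ 1) + h (n ∸ L' ∸ i) + N * h (n ∸ L' ∸ L) + 1)
                ≡ A (n ∸ 1) + A (n ∸ i) + N * A (n ∸ L) + suc N
    regrouped rewrite ∸-comm n i' 1 | ∸-comm n i' i | ∸-comm n i' L | ∸-comm n L' 1 | ∸-comm n L' i | ∸-comm n L' L =
      regroup (h (n ∸ 1 ∸ i')) (h (n ∸ i ∸ i')) (h (n ∸ L ∸ i'))
              (h (n ∸ 1 ∸ L')) (h (n ∸ i ∸ L')) (h (n ∸ L ∸ L')) N

  suc⊓L : ∀ m → suc m ⊓ L ≡ m ⊓ L + χ m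
  suc⊓L m with m <? L
  ... | yes m<L rewrite m≤n⇒m⊓n≡m m<L | m≤n⇒m⊓n≡m (<⇒≤ m<L) | χ-< m<L = +-comm 1 m
  ... | no m≮L with L≤m ← ≮⇒≥ m≮L rewrite m≥n⇒m⊓n≡n (m≤n⇒m≤1+n L≤m) | m≥n⇒m⊓n≡n L≤m | χ-≥ L≤m =
    sym (+-identityʳ L)

  S-recurrence : ∀ m → S m ≡ S (m ∸ 1) + S (m ∸ i) + N * S (m ∸ L) + m ⊓ L
  S-recurrence zero = sym (cong (_+ 0) (*-zeroʳ N))
  S-recurrence (suc m) = begin
    S m + h (suc m)
      ≡⟨ cong₂ _+_ (S-recurrence m) (h-suc m) ⟩
    S (m ∸ 1) + S (m ∸ i) + N * S (m ∸ L) + m ⊓ L + (h m + h (m ∸ i') + N * h (m ∸ L') + χ m)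
      ≡⟨ regroup (S (m ∸ 1)) (S (m ∸ i)) (S (m ∸ L)) (m ⊓ L) (h m) (h (m ∸ i')) (h (m ∸ L')) (χ m) N ⟩
    (S (m ∸ 1) + h m) + (S (m ∸ i) + h (m ∸ i')) + N * (S (m ∸ L) + h (m ∸ L')) + (m ⊓ L + χ m)
      ≡⟨ cong₂ _+_ (cong₂ _+_ (cong₂ _+_ (S-∸ m 0) (S-∸ m i')) (cong (N *_) (S-∸ m L'))) (suc⊓L m) ⟨
    S m + S (m ∸ i') + N * S (m ∸ L') + suc m ⊓ L ∎
    where
    open ≡-Reasoning
    regroup : ∀ a b c d e f g x N →
      a + b + N * c + d + (e + f + N * g + x) ≡ (a + e) + (b + f) + N * (c + g) + (d + x)
    regroup = solve-∀

  B-recurrence : ∀ n → L ≤ n ∸ 1 → B n + suc N ≡ B (n ∸ 1) + B (n ∸ i) + N * B (n ∸ L) + L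
  B-recurrence n L≤n∸1 rewrite S-recurrence (n ∸ 1) | m≥n⇒m⊓n≡n L≤n∸1 | ∸-comm n i 1 | ∸-comm n L 1 =
    regroup (S (n ∸ 1 ∸ 1)) (S (n ∸ 1 ∸ i)) (S (n ∸ 1 ∸ L)) N L
    where
    regroup : ∀ a b c N L → suc (a + b + N * c + L) + suc N ≡ suc a + suc b + N * suc c + L
    regroup = solve-∀

  slack-step : ∀ n {c c₁ c₂ c₃} → L ≤ n ∸ 1 → Slack c₁ (n ∸ 1) → Slack c₂ (n ∸ i) → Slack c₃ (n ∸ L) →
    c + 2 + 2 * N ≤ c₁ + c₂ + N * c₃ + L → Slack c n
  slack-step n {c} {c₁} {c₂} {c₃} L≤n∸1 slack₁ slack₂ slack₃ enough = +-cancelʳ-≤ (suc N) _ _ (begin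
    A n + c + suc N
      ≤⟨ +-monoˡ-≤ (suc N) (+-monoˡ-≤ c (A-≤ n)) ⟩
    A₁ + A₂ + N * A₃ + suc N + c + suc N
      ≡⟨ regroup₁ A₁ A₂ A₃ N c ⟩
    A₁ + A₂ + N * A₃ + (c + 2 + 2 * N)
      ≤⟨ +-monoʳ-≤ (A₁ + A₂ + N * A₃) enough ⟩
    A₁ + A₂ + N * A₃ + (c₁ + c₂ + N * c₃ + L)
      ≡⟨ regroup₂ A₁ A₂ A₃ N c₁ c₂ c₃ L ⟩
    (A₁ + c₁) + (A₂ + c₂) + N * (A₃ + c₃) + L
      ≤⟨ +-monoˡ-≤ L (+-mono-≤ (+-mono-≤ slack₁ slack₂) (*-monoʳ-≤ N slack₃)) ⟩
    B (n ∸ 1) + B (n ∸ i) + N * B (n ∸ L) + L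
      ≡⟨ B-recurrence n L≤n∸1 ⟨
    B n + suc N ∎)
    where
    open ≤-Reasoning
    A₁ A₂ A₃ : ℕ
    A₁ = A (n ∸ 1)
    A₂ = A (n ∸ i)
    A₃ = A (n ∸ L)
    regroup₁ : ∀ a₁ a₂ a₃ N c → a₁ + a₂ + N * a₃ + suc N + c + suc N ≡ a₁ + a₂ + N * a₃ + (c + 2 + 2 * N)
    regroup₁ = solve-∀
    regroup₂ : ∀ a₁ a₂ a₃ N c₁ c₂ c₃ L →
      a₁ + a₂ + N * a₃ + (c₁ + c₂ + N * c₃ + L) ≡ (a₁ + c₁) + (a₂ + c₂) + N * (a₃ + c₃) + L
    regroup₂ = solve-∀

  A-below-L' : ∀ {m} → m ≤ L' → A m ≡ h (m ∸ i')
  A-below-L' {m} m≤L' = trans (cong (λ x → h (m ∸ i') + N * x) (h-∸≡0 m≤L'))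
                                (trans (cong (h (m ∸ i') +_) (*-zeroʳ N)) (+-identityʳ (h (m ∸ i'))))

  slack-below-L' : ∀ m → m ≤ L' → Slack (suc (S (m ∸ 2))) m
  slack-below-L' m m≤L' = begin
    A m + suc (S (m ∸ 2))       ≡⟨ cong (_+ suc (S (m ∸ 2))) (A-below-L' m≤L') ⟩
    h (m ∸ i') + suc (S (m ∸ 2)) ≤⟨ +-monoˡ-≤ (suc (S (m ∸ 2))) (h-mono (∸-monoʳ-≤ m 1≤i')) ⟩
    h (m ∸ 1) + suc (S (m ∸ 2))  ≡⟨ +-suc (h (m ∸ 1)) _ ⟩
    suc (h (m ∸ 1) + S (m ∸ 2))  ≡⟨ cong suc (trans (+-comm (h (m ∸ 1)) _) (sym (S-∸ m 1))) ⟩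
    B m                          ∎
    where open ≤-Reasoning

  slack-at-2 : 2 ≤ i' → Slack 2 2
  slack-at-2 2≤i' = ≤-reflexive (cong (_+ 2) (trans (A-below-L' (≤-trans (s≤s (s≤s z≤n)) 5≤L')) (h-∸≡0 2≤i')))

  -- Closed forms up to L

  h-closed : ∀ k → k ≤ L → h k ≡ k + S (k ∸ i)
  h-closed zero _ = refl
  h-closed (suc k) k<L rewrite h-suc k | h-closed k (<⇒≤ k<L) | h-∸≡0 (s≤s⁻¹ k<L) | *-zeroʳ N | χ-< k<L | S-∸ k i' =
    regroup k (S (k ∸ i)) (h (k ∸ i'))
    where
    regroup : ∀ k s x → k + s + x + 0 + 1 ≡ suc k + (s + x)
    regroup = solve-∀

  Φ : ℕ → ℕ
  Φ zero = 0
  Φ (suc k) = Φ k + S (suc k ∸ i)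

  S-closed : ∀ k → k ≤ L → S k ≡ triangle k + Φ k
  S-closed zero _ = refl
  S-closed (suc k) k<L rewrite S-closed k (<⇒≤ k<L) | h-closed (suc k) k<L =
    regroup (triangle k) (Φ k) k (S (k ∸ i'))
    where
    regroup : ∀ t p k s → t + p + (suc k + s) ≡ t + suc k + (p + s)
    regroup = solve-∀

  triangle≤S : ∀ {n} → n ≤ L → triangle n ≤ S n
  triangle≤S {n} n≤L = subst (triangle n ≤_) (sym (S-closed n n≤L)) (m≤m+n (triangle n) (Φ n))

  2*n≤S+1 : ∀ {n} → n ≤ L → 2 * n ≤ S n + 1
  2*n≤S+1 {n} n≤L = ≤-trans (2*n≤triangle+1 n) (+-monoˡ-≤ 1 (triangle≤S n≤L))

  ≤-S+S : ∀ {x a b} → a ≤ L → b ≤ L → 2 + x ≤ 2 * a + 2 * b → x ≤ S a + S b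
  ≤-S+S {x} {a} {b} a≤L b≤L 2+x≤ = +-cancelˡ-≤ 2 x (S a + S b) (begin
    2 + x               ≤⟨ 2+x≤ ⟩
    2 * a + 2 * b       ≤⟨ +-mono-≤ (2*n≤S+1 a≤L) (2*n≤S+1 b≤L) ⟩
    S a + 1 + (S b + 1) ≡⟨ regroup (S a) (S b) ⟩
    2 + (S a + S b)     ∎)
    where
    open ≤-Reasoning
    regroup : ∀ x y → x + 1 + (y + 1) ≡ 2 + (x + y)
    regroup = solve-∀

  S[n∸i]≤Φ : ∀ n → S (n ∸ i) ≤ Φ n
  S[n∸i]≤Φ zero = z≤n
  S[n∸i]≤Φ (suc n) = m≤n+m _ (Φ n)

  Φ-last-three : ∀ n → 3 ≤ n → S (n ∸ i) + S (n ∸ 1 ∸ i) + S (n ∸ 2 ∸ i) ≤ Φ n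
  Φ-last-three n 3≤n with k , refl ← m≤n⇒∃[o]m+o≡n 3≤n =
    m+o≡n⇒m≤n (Φ k) (regroup (Φ k) (S (suc k ∸ i)) (S (suc (suc k) ∸ i)) (S (3 + k ∸ i)))
    where
    regroup : ∀ p a b c → c + b + a + p ≡ p + a + b + c
    regroup = solve-∀

  -- The slack at L, L + 1 and L + 2

  E : ℕ
  E = L' ∸ i'

  i'≤L' : i' ≤ L'
  i'≤L' = <⇒≤ i'<L'

  E≤L : E ≤ L
  E≤L = ≤-trans (m∸n≤m L' i') (n≤1+n L')

  E∸k≤L : ∀ k → E ∸ k ≤ L
  E∸k≤L k = ≤-trans (m∸n≤m E k) E≤L

  2≤E : 2 ≤ E
  2≤E = subst (_≤ E) (m+n∸m≡n i' 2) (∸-monoˡ-≤ i' i'+2≤L')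

  2+E≤L : 2 + E ≤ L
  2+E≤L = s≤s (subst (1 + E ≤_) (m+[n∸m]≡n i'≤L') (+-monoˡ-≤ E 1≤i'))

  Φ-L : S E + S (E ∸ 1) + S (E ∸ 2) ≤ Φ L
  Φ-L = subst₂ (λ a b → S E + S a + S b ≤ Φ L) (sym (∸-comm L i 1)) (sym (∸-comm L i 2))
          (Φ-last-three L (≤-trans (s≤s (s≤s (s≤s z≤n))) (m≤n⇒m≤1+n 5≤L')))

  E+N+2≤triangle : 7 ≤ L' → E + N + 2 ≤ triangle L'
  E+N+2≤triangle 7≤L' = *-cancelˡ-≤ 2 (begin
    2 * (E + N + 2)                          ≡⟨ double E N ⟩
    2 * E + 2 * N + 4
      ≤⟨ +-monoˡ-≤ 4 (+-mono-≤ (*-monoʳ-≤ 2 (m∸n≤m L' i')) (2*ceilN≤triangle+1 L)) ⟩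
    2 * L' + (triangle L' + suc L' + 1) + 4  ≡⟨ regroup L' (triangle L') ⟩
    triangle L' + (3 * L' + 6)               ≤⟨ +-monoʳ-≤ (triangle L') (3*n+6≤triangle L' 7≤L') ⟩
    triangle L' + triangle L'                ≡⟨ cong (triangle L' +_) (+-identityʳ (triangle L')) ⟨
    2 * triangle L'                          ∎)
    where
    open ≤-Reasoning
    double : ∀ e n → 2 * (e + n + 2) ≡ 2 * e + 2 * n + 4
    double = solve-∀
    regroup : ∀ l t → 2 * l + (t + suc l + 1) + 4 ≡ t + (3 * l + 6)
    regroup = solve-∀

  slack-at-L-large : 7 ≤ L' → Slack 2 L
  slack-at-L-large 7≤L' = begin
    h (L ∸ i') + N * h (L ∸ L') + 2   ≡⟨ cong₂ (λ a b → h a + N * h b + 2) (+-∸-assoc 1 i'≤L') (m+n∸n≡m 1 L') ⟩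
    h (suc E) + N * 1 + 2             ≡⟨ cong (λ x → x + N * 1 + 2) (h-closed (suc E) (s≤s (m∸n≤m L' i'))) ⟩
    suc E + S (E ∸ i') + N * 1 + 2    ≡⟨ regroup E (S (E ∸ i')) N ⟩
    suc (E + N + 2 + S (E ∸ i'))      ≤⟨ s≤s (+-mono-≤ (E+N+2≤triangle 7≤L') S[E∸i']≤Φ) ⟩
    suc (triangle L' + Φ L')          ≡⟨ cong suc (S-closed L' (n≤1+n L')) ⟨
    B L                               ∎
    where
    open ≤-Reasoning
    regroup : ∀ e s n → suc e + s + n * 1 + 2 ≡ suc (e + n + 2 + s)
    regroup = solve-∀
    E∸i'≤L'∸i : E ∸ i' ≤ L' ∸ i
    E∸i'≤L'∸i = subst (E ∸ i' ≤_) (trans (∸-comm L' i' 1) (∸-+-assoc L' 1 i')) (∸-monoʳ-≤ E 1≤i')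
    S[E∸i']≤Φ : S (E ∸ i') ≤ Φ L'
    S[E∸i']≤Φ = ≤-trans (S-mono E∸i'≤L'∸i) (S[n∸i]≤Φ L')

  2+E+S≤Φ : 2 + E + S (suc E ∸ i') ≤ Φ L
  2+E+S≤Φ = ≤-trans bound Φ-L
    where
    open ≤-Reasoning
    bound : 2 + E + S (suc E ∸ i') ≤ S E + S (E ∸ 1) + S (E ∸ 2)
    bound with i' ≟ 1 | i' ≟ 2
    ... | yes i'≡1 | _ = begin
      2 + E + S (suc E ∸ i')       ≡⟨ cong (λ j → 2 + E + S (suc E ∸ j)) i'≡1 ⟩
      2 + E + S E
        ≤⟨ +-monoˡ-≤ (S E) (≤-S+S (E∸k≤L 1) (E∸k≤L 2) (4+n≤2*[n∸1]+2*[n∸2] E 4≤E)) ⟩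
      S (E ∸ 1) + S (E ∸ 2) + S E  ≡⟨ rotate (S E) (S (E ∸ 1)) (S (E ∸ 2)) ⟩
      S E + S (E ∸ 1) + S (E ∸ 2)  ∎
      where
      4≤E : 4 ≤ E
      4≤E = subst (λ j → 4 ≤ L' ∸ j) (sym i'≡1) (∸-monoˡ-≤ 1 5≤L')
      rotate : ∀ a b c → b + c + a ≡ a + b + c
      rotate = solve-∀
    ... | no _ | yes i'≡2 = begin
      2 + E + S (suc E ∸ i')       ≡⟨ cong (λ j → 2 + E + S (suc E ∸ j)) i'≡2 ⟩
      2 + E + S (E ∸ 1)
        ≤⟨ +-monoˡ-≤ (S (E ∸ 1)) (≤-S+S E≤L (E∸k≤L 2) (4+n≤2*n+2*[n∸2] E 3≤E)) ⟩
      S E + S (E ∸ 2) + S (E ∸ 1)  ≡⟨ swap (S E) (S (E ∸ 1)) (S (E ∸ 2)) ⟩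
      S E + S (E ∸ 1) + S (E ∸ 2)  ∎
      where
      3≤E : 3 ≤ E
      3≤E = subst (λ j → 3 ≤ L' ∸ j) (sym i'≡2) (∸-monoˡ-≤ 2 5≤L')
      swap : ∀ a b c → a + c + b ≡ a + b + c
      swap = solve-∀
    ... | no i'≢1 | no i'≢2 =
      +-mono-≤ (≤-S+S E≤L (E∸k≤L 1) (4+n≤2*n+2*[n∸1] E 2≤E)) (S-mono (∸-monoʳ-≤ (suc E) 3≤i'))
      where
      3≤i' : 3 ≤ i'
      3≤i' = ≤∧≢⇒< (≤∧≢⇒< 1≤i' (i'≢1 ∘ sym)) (i'≢2 ∘ sym)

  slack-at-L+1 : Slack 0 (suc L)
  slack-at-L+1 = begin
    h (suc L ∸ i') + N * h (suc L ∸ L') + 0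
      ≡⟨ cong₂ (λ a b → h a + N * b + 0) (+-∸-assoc 2 i'≤L') (trans (cong h (m+n∸n≡m 2 L')) h-2) ⟩
    h (2 + E) + N * 2 + 0                     ≡⟨ cong (λ x → x + N * 2 + 0) (h-closed (2 + E) 2+E≤L) ⟩
    2 + E + S (suc E ∸ i') + N * 2 + 0        ≡⟨ regroup (2 + E + S (suc E ∸ i')) N ⟩
    2 + E + S (suc E ∸ i') + 2 * N            ≤⟨ +-mono-≤ 2+E+S≤Φ (2*ceilN≤triangle+1 L) ⟩
    Φ L + (triangle L + 1)                    ≡⟨ regroup′ (Φ L) (triangle L) ⟩
    suc (triangle L + Φ L)                    ≡⟨ cong suc (S-closed L ≤-refl) ⟨
    B (suc L)                                 ∎
    where
    open ≤-Reasoning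
    regroup : ∀ x n → x + n * 2 + 0 ≡ x + 2 * n
    regroup = solve-∀
    regroup′ : ∀ p t → p + (t + 1) ≡ suc (t + p)
    regroup′ = solve-∀

  triangle+1≤Φ : 8 ≤ L' → i' ≡ 1 → triangle L + 1 ≤ Φ L
  triangle+1≤Φ 8≤L' i'≡1 = begin
    triangle L + 1                         ≤⟨ triangle-sum-gap L' 8≤L' ⟩
    triangle (L' ∸ 1) + triangle (L' ∸ 2)  ≡⟨ cong₂ (λ a b → triangle a + triangle b) E≡L'∸1 E∸1≡L'∸2 ⟨
    triangle E + triangle (E ∸ 1)          ≤⟨ +-mono-≤ (triangle≤S E≤L) (triangle≤S (E∸k≤L 1)) ⟩
    S E + S (E ∸ 1)                        ≤⟨ m≤m+n _ _ ⟩
    S E + S (E ∸ 1) + S (E ∸ 2)            ≤⟨ Φ-L ⟩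
    Φ L                                    ∎
    where
    open ≤-Reasoning
    E≡L'∸1 : E ≡ L' ∸ 1
    E≡L'∸1 = cong (L' ∸_) i'≡1
    E∸1≡L'∸2 : E ∸ 1 ≡ L' ∸ 2
    E∸1≡L'∸2 = trans (cong (_∸ 1) E≡L'∸1) (∸-+-assoc L' 1 1)

  slack-at-L+2-large : 8 ≤ L' → i' ≡ 1 → Slack 0 (2 + L)
  slack-at-L+2-large 8≤L' i'≡1 = begin
    h (2 + L ∸ i') + N * h (2 + L ∸ L') + 0
      ≡⟨ cong₂ (λ a b → h (2 + L ∸ a) + N * b + 0) i'≡1 h-3 ⟩
    h (suc L) + N * 4 + 0
      ≡⟨ regroup (h (suc L)) N ⟩
    2 * (2 * N) + h (suc L)
      ≤⟨ +-monoˡ-≤ (h (suc L)) (*-monoʳ-≤ 2 (2*ceilN≤triangle+1 L)) ⟩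
    2 * (triangle L + 1) + h (suc L)
      ≡⟨ cong (_+ h (suc L)) (double (triangle L)) ⟩
    triangle L + 1 + (triangle L + 1) + h (suc L)
      ≤⟨ +-monoˡ-≤ (h (suc L)) (+-monoʳ-≤ (triangle L + 1) (triangle+1≤Φ 8≤L' i'≡1)) ⟩
    triangle L + 1 + Φ L + h (suc L)
      ≡⟨ regroup′ (triangle L) (Φ L) (h (suc L)) ⟩
    suc (triangle L + Φ L + h (suc L))
      ≡⟨ cong (λ x → suc (x + h (suc L))) (S-closed L ≤-refl) ⟨
    B (2 + L) ∎
    where
    open ≤-Reasoning
    regroup : ∀ x n → x + n * 4 + 0 ≡ 2 * (2 * n) + x
    regroup = solve-∀
    regroup′ : ∀ t p x → t + 1 + p + x ≡ suc (t + p + x)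
    regroup′ = solve-∀
    double : ∀ t → 2 * (t + 1) ≡ t + 1 + (t + 1)
    double = solve-∀
    3≤L : 3 ≤ L
    3≤L = ≤-trans (s≤s (s≤s (s≤s z≤n))) (m≤n⇒m≤1+n 5≤L')
    h-3 : h (2 + L ∸ L') ≡ 4
    h-3 = trans (cong h (m+n∸n≡m 3 L')) (trans (h-closed 3 3≤L) (cong (λ j → 3 + S (2 ∸ j)) i'≡1))

-- Below these bounds the estimates of slack-at-L-large and slack-at-L+2-large fail; the finitely
-- many remaining parameters are checked by evaluation.
slack-at-L-small : ∀ {L'} → L' < 7 → ∀ {i'} → i' < 7 → 1 ≤ i' → i' + 2 ≤ L' → 5 ≤ L' →
  Sequence.Slack i' L' 2 (suc L')
slack-at-L-small = from-yes (allUpTo? (λ L' → allUpTo? (λ i' →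
  1 ≤? i' →-dec (i' + 2 ≤? L' →-dec (5 ≤? L' →-dec Sequence.slack? i' L' 2 (suc L')))) 7) 7)

slack-at-L+2-small : ∀ {L'} → L' < 8 → 5 ≤ L' → Sequence.Slack 1 L' 0 (3 + L')
slack-at-L+2-small = from-yes (allUpTo? (λ L' → 5 ≤? L' →-dec Sequence.slack? 1 L' 0 (3 + L')) 8)

slack-at-L : ∀ {i' L'} → 1 ≤ i' → i' + 2 ≤ L' → 5 ≤ L' → Sequence.Slack i' L' 2 (suc L')
slack-at-L {i'} {L'} 1≤i' i'+2≤L' 5≤L' with 7 ≤? L'
... | yes 7≤L' = Properties.slack-at-L-large i' L' 1≤i' i'+2≤L' 5≤L' 7≤L'
... | no 7≰L' = slack-at-L-small L'<7 (≤-<-trans (≤-trans (m≤m+n i' 2) i'+2≤L') L'<7) 1≤i' i'+2≤L' 5≤L'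
  where
  L'<7 : L' < 7
  L'<7 = ≰⇒> 7≰L'

slack-at-L+2 : ∀ {i' L'} → 1 ≤ i' → i' + 2 ≤ L' → 5 ≤ L' → i' ≡ 1 → Sequence.Slack i' L' 0 (3 + L')
slack-at-L+2 {i'} {L'} 1≤i' i'+2≤L' 5≤L' i'≡1 with 8 ≤? L'
... | yes 8≤L' = Properties.slack-at-L+2-large i' L' 1≤i' i'+2≤L' 5≤L' 8≤L' i'≡1
... | no 8≰L' = subst (λ j → Sequence.Slack j L' 0 (3 + L')) (sym i'≡1) (slack-at-L+2-small (≰⇒> 8≰L') 5≤L')

module Induction (i' L' : ℕ) (1≤i' : 1 ≤ i') (i'+2≤L' : i' + 2 ≤ L') (5≤L' : 5 ≤ L') where

  open Sequence i' L'
  open Properties i' L' 1≤i' i'+2≤L' 5≤L'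

  slack-weaken : ∀ {c c' n} → c' ≤ c → Slack c n → Slack c' n
  slack-weaken c'≤c slack = ≤-trans (+-monoʳ-≤ _ c'≤c) slack

  2≤2*N : 2 ≤ 2 * N
  2≤2*N = *-monoʳ-≤ 2 (1≤ceilN L')

  ≤-offset : ∀ {x y} k m → k ≤ 6 → x ≡ k + m → y ≡ L + m → x ≤ y
  ≤-offset k m k≤6 refl refl = +-monoˡ-≤ m (≤-trans k≤6 (s≤s 5≤L'))

  N*2+L≡L+2*N : N * 2 + L ≡ L + 2 * N
  N*2+L≡L+2*N = trans (+-comm (N * 2) L) (cong (L +_) (*-comm N 2))

  slack-L+2 : Slack 0 (2 + L)
  slack-L+2 with i' ≟ 1
  ... | yes i'≡1 = slack-at-L+2 1≤i' i'+2≤L' 5≤L' i'≡1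
  ... | no i'≢1 = slack-step (2 + L) (n≤1+n L) slack-at-L+1
    (slack-weaken z≤n (slack-below-L' (2 + L ∸ i) (∸-monoʳ-≤ (2 + L') 2≤i')))
    (subst (Slack 2) (sym (m+n∸n≡m 2 L)) (slack-at-2 2≤i'))
    (≤-offset 2 (2 * N) (s≤s (s≤s z≤n)) refl N*2+L≡L+2*N)
    where
    2≤i' : 2 ≤ i'
    2≤i' = ≤∧≢⇒< 1≤i' (i'≢1 ∘ sym)

  slack-up-to-L+2 : ∀ n → n ≤ 2 + L → Slack 0 n
  slack-up-to-L+2 n n≤L+2 with n ≤? L' | n ≟ L | n ≟ suc L
  ... | yes n≤L' | _ | _ = slack-weaken z≤n (slack-below-L' n n≤L')
  ... | no _ | yes refl | _ = slack-weaken z≤n (slack-at-L 1≤i' i'+2≤L' 5≤L')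
  ... | no _ | no _ | yes refl = slack-at-L+1
  ... | no n≰L' | no n≢L | no n≢L+1 = subst (Slack 0) (sym n≡L+2) slack-L+2
    where
    n≡L+2 : n ≡ 2 + L
    n≡L+2 = ≤-antisym n≤L+2 (≤∧≢⇒< (≤∧≢⇒< (≰⇒> n≰L') (n≢L ∘ sym)) (n≢L+1 ∘ sym))

  -- Slack 2 from n = L + 3 on is too little where n - L hits the small slack at L + 1 and L + 2;
  -- this is what the larger slack 2N on [L + 4, 2L] provides.
  record Invariant (n : ℕ) : Set where
    field
      slack₀ : Slack 0 n
      slack₂ : 3 + L ≤ n → Slack 2 n
      slack₂ₙ : 4 + L ≤ n → n ≤ L + L → Slack (2 * N) n
  open Invariant

  Below : ℕ → Set
  Below n = ∀ {m} → m < n → Invariant m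

  earlier : ∀ d → Below (d + L) → ∀ a → 1 ≤ a → Invariant (d + L ∸ a)
  earlier d ih a 1≤a = ih (m∸n<m (≤-trans (s≤s z≤n) (m≤n+m L d)) 1≤a)

  slack-at-d : ∀ {d c} → Slack c d → Slack c (d + L ∸ L)
  slack-at-d {d} {c} = subst (Slack c) (sym (m+n∸n≡m d L))

  slack-L+3 : Below (3 + L) → Slack 2 (3 + L)
  slack-L+3 ih = slack-step (3 + L) (m≤n+m L 2) (slack₀ (earlier 3 ih 1 ≤-refl)) (slack₀ (earlier 3 ih i (s≤s z≤n)))
    (slack-at-d {3} (slack-below-L' 3 (≤-trans (s≤s (s≤s (s≤s z≤n))) 5≤L')))
    (≤-offset 4 (2 * N) (s≤s (s≤s (s≤s (s≤s z≤n)))) refl N*2+L≡L+2*N)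

  slack-window : ∀ d → 4 ≤ d → d ≤ L → Below (d + L) → Slack (2 * N) (d + L)
  slack-window (suc d) 4≤d+1 d<L ih with d ≟ 3
  ... | yes refl = slack-step (4 + L) (m≤n+m L 3)
    (slack₂ (earlier 4 ih 1 ≤-refl) ≤-refl) (slack₀ (earlier 4 ih i (s≤s z≤n)))
    (slack-at-d {4} (subst (λ s → Slack (suc s) 4) S-2 (slack-below-L' 4 (≤-trans (s≤s (s≤s (s≤s (s≤s z≤n)))) 5≤L'))))
    (≤-offset 0 (2 + 4 * N) z≤n (regroup₁ N) (regroup₂ N L))
    where
    S-2 : S 2 ≡ 3
    S-2 = cong (1 +_) h-2
    regroup₁ : ∀ N → 2 * N + 2 + 2 * N ≡ 2 + 4 * N
    regroup₁ = solve-∀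
    regroup₂ : ∀ N L → 2 + N * 4 + L ≡ L + (2 + 4 * N)
    regroup₂ = solve-∀
  ... | no d≢3 = slack-step (suc d + L) (m≤n+m L d)
    (slack₂ₙ (earlier (suc d) ih 1 z<s) (+-monoˡ-≤ L 4≤d) (+-monoˡ-≤ L (<⇒≤ d<L)))
    (slack₀ (earlier (suc d) ih i (s≤s z≤n)))
    (slack-at-d {suc d} slack-at-d+1)
    (≤-offset 2 (4 * N) (s≤s (s≤s z≤n)) (regroup₁ N) (regroup₂ N L))
    where
    4≤d : 4 ≤ d
    4≤d = ≤∧≢⇒< (s≤s⁻¹ 4≤d+1) (d≢3 ∘ sym)
    slack-at-d+1 : Slack 2 (suc d)
    slack-at-d+1 with suc d ≤? L'
    ... | yes d<L' = slack-weaken (s≤s (S-mono {1} (≤-trans (s≤s z≤n) (∸-monoˡ-≤ 1 4≤d))))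
                                   (slack-below-L' (suc d) d<L')
    ... | no d≮L' = subst (Slack 2) (sym (≤-antisym d<L (≰⇒> d≮L'))) (slack-at-L 1≤i' i'+2≤L' 5≤L')
    regroup₁ : ∀ N → 2 * N + 2 + 2 * N ≡ 2 + 4 * N
    regroup₁ = solve-∀
    regroup₂ : ∀ N L → 2 * N + 0 + N * 2 + L ≡ L + 4 * N
    regroup₂ = solve-∀

  slack-beyond : ∀ d → L < d → Below (d + L) → Slack 2 (d + L)
  slack-beyond d L<d ih with d ≟ suc L | d ≟ 2 + L
  ... | yes refl | _ = slack-step (suc L + L) (m≤n+m L L)
    (slack₂ₙ (earlier (suc L) ih 1 z<s) (+-monoˡ-≤ L 4≤L) ≤-refl)
    (slack₀ (earlier (suc L) ih i (s≤s z≤n)))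
    (slack₀ (earlier (suc L) ih L (s≤s z≤n)))
    (≤-offset 4 (2 * N) (s≤s (s≤s (s≤s (s≤s z≤n)))) refl (regroup N L))
    where
    4≤L : 4 ≤ L
    4≤L = ≤-trans (s≤s (s≤s (s≤s (s≤s z≤n)))) (m≤n⇒m≤1+n 5≤L')
    regroup : ∀ N L → 2 * N + 0 + N * 0 + L ≡ L + 2 * N
    regroup = solve-∀
  ... | no _ | yes refl = slack-step (2 + L + L) (m≤n+m L (suc L))
    (slack₀ (earlier (2 + L) ih 1 z<s))
    (slack₂ₙ (earlier (2 + L) ih i (s≤s z≤n)) lower upper)
    (slack₀ (earlier (2 + L) ih L (s≤s z≤n)))
    (≤-offset 4 (2 * N) (s≤s (s≤s (s≤s (s≤s z≤n)))) refl (regroup N L))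
    where
    n∸i≡ : 2 + L + L ∸ i ≡ 2 + L + E
    n∸i≡ = +-∸-assoc (2 + L) (s≤s i'≤L')
    lower : 4 + L ≤ 2 + L + L ∸ i
    lower = subst₂ _≤_ (+-comm (2 + L) 2) (sym n∸i≡) (+-monoʳ-≤ (2 + L) 2≤E)
    rearrange : ∀ L E → L + (2 + E) ≡ 2 + L + E
    rearrange = solve-∀
    upper : 2 + L + L ∸ i ≤ L + L
    upper = subst (_≤ L + L) (trans (rearrange L E) (sym n∸i≡)) (+-monoʳ-≤ L 2+E≤L)
    regroup : ∀ N L → 2 * N + N * 0 + L ≡ L + 2 * N
    regroup = solve-∀
  ... | no d≢L+1 | no d≢L+2 = slack-step (d + L) (subst (L ≤_) (sym (+-∸-comm L 1≤d)) (m≤n+m L (d ∸ 1)))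
    (slack₀ (earlier d ih 1 z<s))
    (slack₀ (earlier d ih i (s≤s z≤n)))
    (slack-at-d {d} (slack₂ (ih (m<m+n d z<s)) 3+L≤d))
    (≤-offset 4 (2 * N) (s≤s (s≤s (s≤s (s≤s z≤n)))) refl N*2+L≡L+2*N)
    where
    1≤d : 1 ≤ d
    1≤d = ≤-trans (s≤s z≤n) L<d
    3+L≤d : 3 + L ≤ d
    3+L≤d = ≤∧≢⇒< (≤∧≢⇒< L<d (d≢L+1 ∘ sym)) (d≢L+2 ∘ sym)

  invariant-from-L+3 : ∀ d → 3 ≤ d → Below (d + L) → Invariant (d + L)
  invariant-from-L+3 d 3≤d ih with d ≟ 3 | d ≤? L
  ... | yes refl | _ = record
    { slack₀ = slack-weaken z≤n slack
    ; slack₂ = λ _ → slack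
    ; slack₂ₙ = λ 4+L≤3+L _ → ⊥-elim (<-irrefl refl 4+L≤3+L) }
    where
    slack : Slack 2 (3 + L)
    slack = slack-L+3 ih
  ... | no d≢3 | yes d≤L = record
    { slack₀ = slack-weaken z≤n slack
    ; slack₂ = λ _ → slack-weaken 2≤2*N slack
    ; slack₂ₙ = λ _ _ → slack }
    where
    slack : Slack (2 * N) (d + L)
    slack = slack-window d (≤∧≢⇒< 3≤d (d≢3 ∘ sym)) d≤L ih
  ... | no _ | no d≰L = record
    { slack₀ = slack-weaken z≤n slack
    ; slack₂ = λ _ → slack
    ; slack₂ₙ = λ _ d+L≤L+L → ⊥-elim (d≰L (+-cancelʳ-≤ L d L d+L≤L+L)) }
    where
    slack : Slack 2 (d + L)
    slack = slack-beyond d (≰⇒> d≰L) ih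

  invariant : ∀ n → Invariant n
  invariant = <-rec Invariant step
    where
    step : ∀ n → Below n → Invariant n
    step n ih with n ≤? 2 + L
    ... | yes n≤L+2 = record
      { slack₀ = slack-up-to-L+2 n n≤L+2
      ; slack₂ = λ 3+L≤n → ⊥-elim (<-irrefl refl (≤-trans 3+L≤n n≤L+2))
      ; slack₂ₙ = λ 4+L≤n _ → ⊥-elim (<-irrefl refl (≤-trans (m≤n⇒m≤1+n 4+L≤n) (s≤s n≤L+2))) }
    ... | no n≰L+2 =
      subst Invariant (m∸n+n≡m L≤n) (invariant-from-L+3 (n ∸ L) 3≤n∸L (ih ∘ subst (_ <_) (m∸n+n≡m L≤n)))
      where
      3+L≤n : 3 + L ≤ n
      3+L≤n = ≰⇒> n≰L+2
      L≤n : L ≤ n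
      L≤n = ≤-trans (m≤n+m L 3) 3+L≤n
      3≤n∸L : 3 ≤ n ∸ L
      3≤n∸L = subst (_≤ n ∸ L) (m+n∸n≡m 3 L) (∸-monoˡ-≤ L 3+L≤n)

  brown : ∀ n → h (suc n) ≤ suc (S n)
  brown n with n <? L
  ... | yes n<L = brown-below-L n n<L
  ... | no n≮L = brown-from-slack n (≮⇒≥ n≮L) (slack₀ (invariant n))

mainTheorem10 : (L i : ℕ) → 6 ≤ L → 2 ≤ i → i ≤ L ∸ 2 →
    Complete (H (coeffs L i))
mainTheorem10 (suc L') (suc i') (s≤s 5≤L') (s≤s 1≤i') i≤L∸2 = Brown.complete h h-positive brown
  where
  i'+2≤L' : i' + 2 ≤ L'
  i'+2≤L' = subst (_≤ L') (sym (+-suc i' 1)) (m≤o∸n⇒m+n≤o (suc i') (≤-trans (s≤s z≤n) 5≤L') i≤L∸2)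
  open Sequence i' L' using (h)
  open Properties i' L' 1≤i' i'+2≤L' 5≤L' using (h-positive)
  open Induction i' L' 1≤i' i'+2≤L' 5≤L' using (brown)
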